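{- Let $\mathfrak{S}$ be the category of Bochvar systems and $\mathfrak{B}$ the category of Bochvar algebras with homomorphisms. Define $\Xi$ by $\Xi(\mathbb{B}):=\mathbf{A}_{\mathbb{B}}$ on objects and, for a morphism $g:\langle\mathbf{B}_1,\mathbf{I}_1\rangle\to\langle\mathbf{B}_2,\mathbf{I}_2\rangle$ in $\mathfrak{S}$, $\Xi(g)(a/[i)):=g(a)/[g(i))$ for $a\in B_1$, $i\in I_1$. Then $\Xi$ is a functor from $\mathfrak{S}$ to $\mathfrak{B}$.
   Context: A Bochvar system is a pair $\langle\mathbf{B},\mathbf{I}\rangle$ with $\mathbf{B}$ a Boolean algebra and $I\subseteq B$ containing $1$ and closed under $\wedge$; a morphism $\langle\mathbf{B}_1,\mathbf{I}_1\rangle\to\langle\mathbf{B}_2,\mathbf{I}_2\rangle$ is a Boolean homomorphism $g$ with $g(i)\in I_2$ for all $i\in I_1$. Bochvar algebras: $\mathbf{WK}^e$ is the algebra on $\{0,\tfrac12,1\}$ of type $\langle\wedge,\vee,\neg,J_2,0,1\rangle$ with $\neg0=1,\neg\tfrac12=\tfrac12,\neg1=0$, $\vee,\wedge$ Boolean on $\{0,1\}$ and outputting $\tfrac12$ whenever an argument is $\tfrac12$, $J_21=1$, $J_2\tfrac12=J_20=0$; Bochvar algebras form $ISP(\mathbf{WK}^e)$. $\mathbf{A}_{\mathbb{B}}$ is the unique Bochvar algebra whose $\langle\wedge,\vee,\neg,0,1\rangle$-reduct is the Płonka sum of the semilattice direct system with fibres $\mathbf{B}/[i)$ ($i\in I$,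 $[i)$ the principal filter of $\mathbf{B}$ generated by $i$), index join-semilattice $I$ ordered by $i\le j$ iff $j\le_{\mathbf{B}} i$ (join $i\wedge j$, least element $1$), and maps $p_{ij}(a/[i))=a/[j)$. (Płonka sum: operations on elements of fibres $A_{i_1},\dots,A_{i_n}$ are computed in the fibre of $i_1\vee\dots\vee i_n$ after mapping the arguments there by the $p$'s; constants are those of the bottom fibre.) -}

module Defs where

open import Level using (Level; _⊔_; suc)
open import Data.Product using (Σ; _×_; _,_; proj₁; proj₂)
open import Relation.Binary using (Rel)
open import Algebra.Lattice.Bundles using (BooleanAlgebra)

record BochvarSystem (c ℓ : Level) : Set (suc (c ⊔ ℓ)) where
  field
    B       : BooleanAlgebra c ℓ
  open BooleanAlgebra B public
  field
    I       : Carrier → Set ℓ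
    I-resp  : ∀ {x y} → x ≈ y → I x → I y
    I-⊤     : I ⊤
    I-∧     : ∀ {x y} → I x → I y → I (x ∧ y)

record IsBoolHom {c₁ ℓ₁ c₂ ℓ₂} (B₁ : BooleanAlgebra c₁ ℓ₁) (B₂ : BooleanAlgebra c₂ ℓ₂)
         (g : BooleanAlgebra.Carrier B₁ → BooleanAlgebra.Carrier B₂) : Set (c₁ ⊔ ℓ₁ ⊔ ℓ₂) where
  private
    module X = BooleanAlgebra B₁
    module Y = BooleanAlgebra B₂
  field
    cong   : ∀ {x y} → x X.≈ y → g x Y.≈ g y
    pres-∧ : ∀ x y → g (x X.∧ y) Y.≈ (g x Y.∧ g y)
    pres-∨ : ∀ x y → g (x X.∨ y) Y.≈ (g x Y.∨ g y)
    pres-¬ : ∀ x → g (X.¬ x) Y.≈ (Y.¬ g x)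
    pres-⊤ : g X.⊤ Y.≈ Y.⊤
    pres-⊥ : g X.⊥ Y.≈ Y.⊥

record SysHom {c ℓ} (S₁ S₂ : BochvarSystem c ℓ) : Set (c ⊔ ℓ) where
  private
    module X = BochvarSystem S₁
    module Y = BochvarSystem S₂
  field
    fun    : X.Carrier → Y.Carrier
    isHom  : IsBoolHom X.B Y.B fun
    pres-I : ∀ {i} → X.I i → Y.I (fun i)

idSysHom : ∀ {c ℓ} (S : BochvarSystem c ℓ) → SysHom S S
idSysHom S = record
  { fun = λ x → x
  ; isHom = record
    { cong = λ p → p ; pres-∧ = λ _ _ → refl ; pres-∨ = λ _ _ → refl
    ; pres-¬ = λ _ → refl ; pres-⊤ = refl ; pres-⊥ = refl }
  ; pres-I = λ p → p }
  where open BochvarSystem S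

compSysHom : ∀ {c ℓ} {S₁ S₂ S₃ : BochvarSystem c ℓ} →
             SysHom S₂ S₃ → SysHom S₁ S₂ → SysHom S₁ S₃
compSysHom {S₁ = S₁} {S₂} {S₃} g h = record
  { fun = λ x → G (H x)
  ; isHom = record
    { cong   = λ p → Gh.cong (Hh.cong p)
    ; pres-∧ = λ x y → Z.trans (Gh.cong (Hh.pres-∧ x y)) (Gh.pres-∧ (H x) (H y))
    ; pres-∨ = λ x y → Z.trans (Gh.cong (Hh.pres-∨ x y)) (Gh.pres-∨ (H x) (H y))
    ; pres-¬ = λ x → Z.trans (Gh.cong (Hh.pres-¬ x)) (Gh.pres-¬ (H x))
    ; pres-⊤ = Z.trans (Gh.cong Hh.pres-⊤) Gh.pres-⊤
    ; pres-⊥ = Z.trans (Gh.cong Hh.pres-⊥) Gh.pres-⊥ }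
  ; pres-I = λ p → SysHom.pres-I g (SysHom.pres-I h p) }
  where
    module Z = BochvarSystem S₃
    G = SysHom.fun g
    H = SysHom.fun h
    module Gh = IsBoolHom (SysHom.isHom g)
    module Hh = IsBoolHom (SysHom.isHom h)

record BochvarSig (c ℓ : Level) : Set (suc (c ⊔ ℓ)) where
  field
    Carrier : Set c
    _≈_     : Rel Carrier ℓ
    _∧_     : Carrier → Carrier → Carrier
    _∨_     : Carrier → Carrier → Carrier
    ¬_      : Carrier → Carrier
    J₂      : Carrier → Carrier
    𝟘       : Carrier
    𝟙       : Carrier

record IsBochvarHom {c₁ ℓ₁ c₂ ℓ₂} (A₁ : BochvarSig c₁ ℓ₁) (A₂ : BochvarSig c₂ ℓ₂)
         (f : BochvarSig.Carrier A₁ → BochvarSig.Carrier A₂) : Set (c₁ ⊔ ℓ₁ ⊔ ℓ₂) where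
  private
    module X = BochvarSig A₁
    module Y = BochvarSig A₂
  field
    cong    : ∀ {x y} → x X.≈ y → f x Y.≈ f y
    pres-∧  : ∀ x y → f (x X.∧ y) Y.≈ (f x Y.∧ f y)
    pres-∨  : ∀ x y → f (x X.∨ y) Y.≈ (f x Y.∨ f y)
    pres-¬  : ∀ x → f (X.¬ x) Y.≈ (Y.¬ f x)
    pres-J₂ : ∀ x → f (X.J₂ x) Y.≈ Y.J₂ (f x)
    pres-𝟘  : f X.𝟘 Y.≈ Y.𝟘
    pres-𝟙  : f X.𝟙 Y.≈ Y.𝟙

-- The algebra A_𝔹 (Płonka sum of the fibres B/[i), i ∈ I)
--
-- An element a/[i) of the fibre over i ∈ I is represented by a triple
-- (i , i∈I , a).  Two representatives are equal iff they lie in the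
-- same fibre (i ≈ j) and a/[i) = b/[i), i.e. a ∧ i ≈ b ∧ i
-- (congruence modulo the principal filter [i)).

record Elt {c ℓ} (S : BochvarSystem c ℓ) : Set (c ⊔ ℓ) where
  constructor _/[_,_⟩
  open BochvarSystem S
  field
    elt   : Carrier
    idx   : Carrier
    idx∈I : I idx

module _ {c ℓ} (S : BochvarSystem c ℓ) where
  open BochvarSystem S renaming (_∧_ to _⊓_; _∨_ to _⊔'_; ¬_ to ∼_)
  open Elt

  A : BochvarSig (c ⊔ ℓ) ℓ
  A = record
    { Carrier = Elt S
    ; _≈_ = λ x y → (idx x ≈ idx y) × ((elt x ⊓ idx x) ≈ (elt y ⊓ idx y))
    -- Płonka sum: join of indices i ∨_I j = i ∧ j; p_{ij}(a/[i)) = a/[j)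
    ; _∧_ = λ x y → (elt x ⊓ elt y) /[ idx x ⊓ idx y , I-∧ (idx∈I x) (idx∈I y) ⟩
    ; _∨_ = λ x y → (elt x ⊔' elt y) /[ idx x ⊓ idx y , I-∧ (idx∈I x) (idx∈I y) ⟩
    ; ¬_  = λ x → (∼ elt x) /[ idx x , idx∈I x ⟩
    ; J₂  = λ x → (elt x ⊓ idx x) /[ ⊤ , I-⊤ ⟩
    -- constants live in the bottom fibre (index 1)
    ; 𝟘   = ⊥ /[ ⊤ , I-⊤ ⟩
    ; 𝟙   = ⊤ /[ ⊤ , I-⊤ ⟩
    }

Ξ : ∀ {c ℓ} {S₁ S₂ : BochvarSystem c ℓ} → SysHom S₁ S₂ → Elt S₁ → Elt S₂
Ξ g (a /[ i , i∈I ⟩) = SysHom.fun g a /[ SysHom.fun g i , SysHom.pres-I g i∈I ⟩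

-- Ξ(g) is well defined because g(a ∧ i) = g a ∧ g i carries congruence modulo
-- [i) to congruence modulo [g i); it preserves the Płonka-sum operations
-- because they act by Boolean operations on both the element and the index,
-- and g preserves those (including the index ⊤ of the bottom fibre).
module Submission where

open import Defs
open import Data.Product using (_×_; _,_)

module _ {c ℓ} {S₁ S₂ : BochvarSystem c ℓ} (g : SysHom S₁ S₂) where
  private
    module X = BochvarSystem S₁
    module Y = BochvarSystem S₂
    open SysHom g using (fun; isHom)
    open IsBoolHom isHom

  fun-resp-∧-≈ : ∀ {a i b j} → (a X.∧ i) X.≈ (b X.∧ j) →
                 (fun a Y.∧ fun i) Y.≈ (fun b Y.∧ fun j)
  fun-resp-∧-≈ {a} {i} {b} {j} a∧i≈b∧j =
    Y.trans (Y.sym (pres-∧ a i)) (Y.trans (cong a∧i≈b∧j) (pres-∧ b j))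

  Ξ-isBochvarHom : IsBochvarHom (A S₁) (A S₂) (Ξ g)
  Ξ-isBochvarHom = record
    { cong    = λ (i≈j , a∧i≈b∧j) → cong i≈j , fun-resp-∧-≈ a∧i≈b∧j
    ; pres-∧  = λ _ _ → pres-∧ _ _ , Y.∧-cong (pres-∧ _ _) (pres-∧ _ _)
    ; pres-∨  = λ _ _ → pres-∧ _ _ , Y.∧-cong (pres-∨ _ _) (pres-∧ _ _)
    ; pres-¬  = λ _ → Y.refl , Y.∧-cong (pres-¬ _) Y.refl
    ; pres-J₂ = λ _ → pres-⊤ , Y.∧-cong (pres-∧ _ _) pres-⊤
    ; pres-𝟘  = pres-⊤ , Y.∧-cong pres-⊥ pres-⊤
    ; pres-𝟙  = pres-⊤ , Y.∧-cong pres-⊤ pres-⊤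
    }

-- Both functor laws hold on representatives up to definitional equality.
Ξ-id : ∀ {c ℓ} (S : BochvarSystem c ℓ) (x : Elt S) →
       BochvarSig._≈_ (A S) (Ξ (idSysHom S) x) x
Ξ-id S x = refl , refl
  where open BochvarSystem S using (refl)

Ξ-∘ : ∀ {c ℓ} {S₁ S₂ S₃ : BochvarSystem c ℓ} (g : SysHom S₂ S₃) (h : SysHom S₁ S₂) (x : Elt S₁) →
      BochvarSig._≈_ (A S₃) (Ξ (compSysHom g h) x) (Ξ g (Ξ h x))
Ξ-∘ {S₃ = S₃} g h x = refl , refl
  where open BochvarSystem S₃ using (refl)

lemma3p8 : ∀ {c ℓ} →
    ((S₁ S₂ : BochvarSystem c ℓ) (g : SysHom S₁ S₂) → IsBochvarHom (A S₁) (A S₂) (Ξ g))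
    × ((S : BochvarSystem c ℓ) (x : Elt S) → BochvarSig._≈_ (A S) (Ξ (idSysHom S) x) x)
    × ((S₁ S₂ S₃ : BochvarSystem c ℓ) (g : SysHom S₂ S₃) (h : SysHom S₁ S₂) (x : Elt S₁) →
        BochvarSig._≈_ (A S₃) (Ξ (compSysHom g h) x) (Ξ g (Ξ h x)))
lemma3p8 = (λ _ _ g → Ξ-isBochvarHom g)
         , Ξ-id
         , (λ _ _ _ → Ξ-∘)
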